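{- Let $G=(V,E)$ be a simple graph with $n=|V|$. Consider the system, in unknowns $x=(x^i_v)_{i\in\{0,\dots,n-1\},v\in V}$, $\lambda=(\lambda_v)_{v\in V}$, $\nu=(\nu_i)_{i=0}^{n-1}$: for all $v\in V$: $2x^0_v+\sum_{u:(v,u)\in\overline{E}(G)}\left(x^1_u+x^{n-1}_u\right)-\lambda_v-\nu_0=0$; for all $v\in V$ and $i=1,\dots,n-2$: $2x^i_v+\sum_{u:(v,u)\in\overline{E}(G)}\left(x^{i-1}_u+x^{i+1}_u\right)-\lambda_v-\nu_i=0$; for all $v\in V$: $2x^{n-1}_v+\sum_{u:(v,u)\in\overline{E}(G)}\left(x^{n-2}_u+x^0_u\right)-\lambda_v-\nu_{n-1}=0$; for all $i=0,\dots,n-1$: $\sum_{v\in V}x^i_v=1$; for all $v\in V$: $\sum_{i=0}^{n-1}x^i_v=1$; and $x^i_v\ge 0$ for all $i,v$. Then the feasible solution set of this system contains a solution $(x,\lambda,\nu)$ with $\lambda\ge 0$ and $\nu\ge 0$.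
   Context: $\overline{E}(G)=V^2\setminus E(G)$, i.e. the set of pairs $(v,u)\in V\times V$ with $\{v,u\}\notin E(G)$. -}

module Defs where

open import Data.Bool using (Bool; true; false; if_then_else_)
open import Data.Nat using (ℕ; zero; suc; _%_)
import Data.Nat as ℕ
open import Data.Nat.DivMod using (m%n<n)
open import Data.Fin using (Fin; zero; suc; toℕ; fromℕ<)
open import Data.Rational using (ℚ; 0ℚ; 1ℚ; _+_; _-_; _≤_)
open import Data.Product using (_×_)
open import Relation.Binary.PropositionalEquality using (_≡_)

record SimpleGraph (n : ℕ) : Set where
  field
    adj   : Fin n → Fin n → Bool
    sym   : ∀ u v → adj u v ≡ adj v u
    irrefl : ∀ v → adj v v ≡ false
open SimpleGraph public

Σ[_] : (n : ℕ) → (Fin n → ℚ) → ℚ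
Σ[ zero ] f = 0ℚ
Σ[ suc n ] f = f zero + Σ[ n ] (λ i → f (suc i))

-- Sum of f u over all u with (v,u) ∈ Ē(G) = V² \ E(G), i.e. {v,u} ∉ E(G)
-- (this includes u = v, since a simple graph has no loops).
Σ-nonadj : ∀ {n} → SimpleGraph n → Fin n → (Fin n → ℚ) → ℚ
Σ-nonadj {n} G v f = Σ[ n ] (λ u → if adj G v u then 0ℚ else f u)

next : ∀ {n} → Fin n → Fin n
next {suc m} i = fromℕ< (m%n<n (suc (toℕ i)) (suc m))

prev : ∀ {n} → Fin n → Fin n
prev {suc m} i = fromℕ< (m%n<n (toℕ i ℕ.+ m) (suc m))

-- The system of the proposition; x i v stands for x^i_v.
-- For i = 0 the neighbour indices are 1 and n-1, for 1 ≤ i ≤ n-2 they are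
-- i-1 and i+1, for i = n-1 they are n-2 and 0: i.e. prev i and next i.
record Feasible {n : ℕ} (G : SimpleGraph n)
                (x : Fin n → Fin n → ℚ) (lam : Fin n → ℚ) (nu : Fin n → ℚ) : Set where
  field
    stationarity : ∀ (i v : Fin n) →
      (x i v + x i v) + Σ-nonadj G v (λ u → x (prev i) u + x (next i) u)
        - lam v - nu i ≡ 0ℚ
    rowSum  : ∀ (i : Fin n) → Σ[ n ] (λ v → x i v) ≡ 1ℚ
    colSum  : ∀ (v : Fin n) → Σ[ n ] (λ i → x i v) ≡ 1ℚ
    nonneg  : ∀ (i v : Fin n) → 0ℚ ≤ x i v

-- The uniform matrix x^i_v = 1/n is doubly stochastic and nonnegative, and
-- since it does not depend on i, neither does the left-hand side of the
-- stationarity equations once ν = 0. So λ_v can be defined as that left-hand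
-- side, and it is nonnegative as a sum of nonnegative terms.
module Submission where

open import Defs
open import Data.Nat using (ℕ; zero; suc)
open import Data.Fin using (Fin)
open import Data.Bool using (true; false; if_then_else_)
open import Data.Rational
  using (ℚ; 0ℚ; 1ℚ; _≤_; _+_; _*_; _-_; 1/_; Positive; NonZero; nonNegative)
open import Data.Rational.Properties
open import Data.Product using (Σ; _×_; _,_)
open import Relation.Binary.PropositionalEquality
  using (_≡_; cong; cong₂; subst; module ≡-Reasoning)
  renaming (sym to ≡-sym)

0≤+ : ∀ {p q} → 0ℚ ≤ p → 0ℚ ≤ q → 0ℚ ≤ p + q
0≤+ {p} {q} 0≤p 0≤q = subst (_≤ p + q) (+-identityʳ 0ℚ) (+-mono-≤ 0≤p 0≤q)

0≤Σ : ∀ k (f : Fin k → ℚ) → (∀ i → 0ℚ ≤ f i) → 0ℚ ≤ Σ[ k ] f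
0≤Σ zero    f 0≤f = ≤-refl
0≤Σ (suc k) f 0≤f = 0≤+ (0≤f Fin.zero) (0≤Σ k (λ i → f (Fin.suc i)) (λ i → 0≤f (Fin.suc i)))

0≤Σ-nonadj : ∀ {n} (G : SimpleGraph n) v (f : Fin n → ℚ) →
             (∀ u → 0ℚ ≤ f u) → 0ℚ ≤ Σ-nonadj G v f
0≤Σ-nonadj {n} G v f 0≤f = 0≤Σ n _ (λ u → 0≤if (adj G v u) (0≤f u))
  where
  0≤if : ∀ b {q} → 0ℚ ≤ q → 0ℚ ≤ (if b then 0ℚ else q)
  0≤if true  _   = ≤-refl
  0≤if false 0≤q = 0≤q

-- The rational k, built as a sum so that Σ-const needs no cast lemmas.
ones : ℕ → ℚ
ones k = Σ[ k ] (λ _ → 1ℚ)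

ones-suc-positive : ∀ m → Positive (ones (suc m))
ones-suc-positive m =
  pos+nonNeg⇒pos 1ℚ (ones m) {{nonNegative (0≤Σ m _ (λ _ → nonNegative⁻¹ 1ℚ))}}

Σ-const : ∀ k c → Σ[ k ] (λ _ → c) ≡ ones k * c
Σ-const zero    c = ≡-sym (*-zeroˡ c)
Σ-const (suc k) c = begin
  c + Σ[ k ] (λ _ → c)  ≡⟨ cong₂ _+_ (≡-sym (*-identityˡ c)) (Σ-const k c) ⟩
  1ℚ * c + ones k * c   ≡⟨ ≡-sym (*-distribʳ-+ c 1ℚ (ones k)) ⟩
  (1ℚ + ones k) * c     ∎
  where open ≡-Reasoning

module Uniform (m : ℕ) where

  instance
    ones-positive : Positive (ones (suc m))
    ones-positive = ones-suc-positive m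

    ones-nonZero : NonZero (ones (suc m))
    ones-nonZero = pos⇒nonZero (ones (suc m))

  weight : ℚ
  weight = 1/ ones (suc m)

  0≤weight : 0ℚ ≤ weight
  0≤weight = nonNegative⁻¹ weight {{pos⇒nonNeg weight {{1/pos⇒pos (ones (suc m))}}}}

  Σ-weight : Σ[ suc m ] (λ _ → weight) ≡ 1ℚ
  Σ-weight = begin
    Σ[ suc m ] (λ _ → weight)  ≡⟨ Σ-const (suc m) weight ⟩
    ones (suc m) * weight      ≡⟨ *-inverseʳ (ones (suc m)) ⟩
    1ℚ                         ∎
    where open ≡-Reasoning

proposition2 : (n : ℕ) (G : SimpleGraph n) →
    Σ (Fin n → Fin n → ℚ) λ x → Σ (Fin n → ℚ) λ lam → Σ (Fin n → ℚ) λ nu →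
    Feasible G x lam nu × ((v : Fin n) → 0ℚ ≤ lam v) × ((i : Fin n) → 0ℚ ≤ nu i)
proposition2 zero G = (λ ()) , (λ ()) , (λ ()) ,
  record { stationarity = λ () ; rowSum = λ () ; colSum = λ () ; nonneg = λ () } ,
  (λ ()) , (λ ())
proposition2 (suc m) G = (λ _ _ → weight) , lam , (λ _ → 0ℚ) , feasible , 0≤lam , (λ _ → ≤-refl)
  where
  open Uniform m

  lam : Fin (suc m) → ℚ
  lam v = (weight + weight) + Σ-nonadj G v (λ _ → weight + weight)

  0≤lam : ∀ v → 0ℚ ≤ lam v
  0≤lam v = 0≤+ 0≤2weight (0≤Σ-nonadj G v _ (λ _ → 0≤2weight))
    where
    0≤2weight : 0ℚ ≤ weight + weight
    0≤2weight = 0≤+ 0≤weight 0≤weight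

  feasible : Feasible G (λ _ _ → weight) lam (λ _ → 0ℚ)
  feasible = record
    { stationarity = λ i v → cong (_- 0ℚ) (+-inverseʳ (lam v))
    ; rowSum       = λ _ → Σ-weight
    ; colSum       = λ _ → Σ-weight
    ; nonneg       = λ _ _ → 0≤weight
    }
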